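{- Let $(a_n)_{n\ge1}$ be a periodic E-sequence, i.e. there are integers $l\ge0$, $r\ge1$ with $a_n=a_{n+r}$ for all $n>l$, and let $s=a_{l+1}+a_{l+2}+\cdots+a_{l+r}$. If $3^r>2^s$, then $(a_n)$ is $\Omega$-divergent.
   Context: An E-sequence is any infinite sequence $(a_n)_{n\ge1}$ of positive integers. For an odd positive integer $x$, its E-sequence $(a_n)_{n\ge1}$ is defined by $x_0=x$ and, for $n\ge1$, $x_n=\frac{3x_{n-1}+1}{2^{a_n}}$, where $a_n$ is the exponent of the largest power of $2$ dividing $3x_{n-1}+1$. An E-sequence is $\Omega$-divergent if it is not the E-sequence of any odd positive integer. -}

module Defs where

open import Data.Nat using (ℕ; zero; suc; _+_; _*_; _^_; _<_; _≤_)
open import Data.Nat.Divisibility using (_∣_)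
open import Data.Product using (Σ; _×_)
open import Relation.Nullary using (¬_)
open import Relation.Binary.PropositionalEquality using (_≡_)

Odd : ℕ → Set
Odd m = ¬ (2 ∣ m)

-- An E-sequence (a_n)_{n≥1} is represented as a function a : ℕ → ℕ,
-- where only the values a n for n ≥ 1 matter (a 0 is ignored);
-- it must consist of positive integers: a n ≥ 1 for all n ≥ 1.
IsESeq : (ℕ → ℕ) → Set
IsESeq a = ∀ n → 1 ≤ n → 1 ≤ a n

-- (a_n) is the E-sequence of the odd positive integer x:
-- there is the orbit xs with xs 0 = x and, for n ≥ 1,
-- 3·xs(n-1)+1 = 2^(a n) · xs n with xs n odd, i.e. a n is the exponent of
-- the largest power of 2 dividing 3·xs(n-1)+1 and xs n = (3 xs(n-1)+1)/2^(a n).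
IsESeqOf : ℕ → (ℕ → ℕ) → Set
IsESeqOf x a =
  Σ (ℕ → ℕ) λ xs →
    (xs 0 ≡ x) × (∀ n → 3 * xs n + 1 ≡ 2 ^ a (suc n) * xs (suc n))
                × (∀ n → Odd (xs n))

ΩDivergent : (ℕ → ℕ) → Set
ΩDivergent a = ∀ x → 1 ≤ x → Odd x → ¬ IsESeqOf x a

blockSum : (ℕ → ℕ) → ℕ → ℕ → ℕ
blockSum a l zero = 0
blockSum a l (suc r) = blockSum a l r + a (l + suc r)

module Submission where

-- Suppose the periodic E-sequence a were the E-sequence of an
-- odd x, with orbit xs.  Composing the r single steps 2^{a(n+1)} x_{n+1} =
-- 3 x_n + 1 of one period gives an affine relation
--   2^S · xs(m + r) = 3^r · xs m + c,      S = a(m+1) + … + a(m+r),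
-- whose coefficients depend only on the window a(m+1), …, a(m+r).  By
-- periodicity the samples y k = xs(l + k r) all obey the SAME relation
-- 2^S y(k+1) = 3^r y k + c.  Since 2^S < 3^r, the shift z k = (3^r - 2^S) y k + c
-- turns it into the linear relation 2^S z(k+1) = 3^r z k, so
-- 2^(S k) z k = 3^(r k) z 0 and, 2 and 3 being coprime, 2^(S k) divides z 0
-- for every k.  As z 0 ≥ c ≥ 1 and S ≥ 1 this is impossible (take k = z 0).

open import Defs
open import Data.Nat using (ℕ; zero; suc; _∸_; _+_; _*_; _^_; _<_; _≤_; z≤n; s≤s; >-nonZero)
open import Data.Nat.Properties
open import Data.Nat.Divisibility
open import Data.Nat.Coprimality using (Coprime; coprime?; coprime-divisor)
open import Data.Nat.Solver using (module +-*-Solver)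
open import Data.Product using (_,_)
open import Relation.Nullary using (¬_)
open import Relation.Nullary.Decidable using (toWitness)
open import Relation.Binary.PropositionalEquality
open +-*-Solver

OrbitOf : (ℕ → ℕ) → (ℕ → ℕ) → Set
OrbitOf a xs = ∀ n → 3 * xs n + 1 ≡ 2 ^ a (suc n) * xs (suc n)

-- The constant term of the composite of the j steps after position m:
-- c_0 = 0 and c_{j+1} = 3 c_j + 2^{a(m+1)+…+a(m+j)}.
blockConst : (ℕ → ℕ) → ℕ → ℕ → ℕ
blockConst a m zero = 0
blockConst a m (suc j) = 3 * blockConst a m j + 2 ^ blockSum a m j

orbit-block : ∀ a xs → OrbitOf a xs → ∀ m j →
  2 ^ blockSum a m j * xs (m + j) ≡ 3 ^ j * xs m + blockConst a m j
orbit-block a xs orbit m zero rewrite +-identityʳ m = sym (+-identityʳ _)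
orbit-block a xs orbit m (suc j) = begin
    2 ^ (S + a (m + suc j)) * xs (m + suc j)
      ≡⟨ cong (λ t → 2 ^ (S + a t) * xs t) (+-suc m j) ⟩
    2 ^ (S + a (suc (m + j))) * xs (suc (m + j))
      ≡⟨ cong (_* xs (suc (m + j))) (^-distribˡ-+-* 2 S (a (suc (m + j)))) ⟩
    2 ^ S * 2 ^ a (suc (m + j)) * xs (suc (m + j))
      ≡⟨ *-assoc (2 ^ S) _ _ ⟩
    2 ^ S * (2 ^ a (suc (m + j)) * xs (suc (m + j)))
      ≡⟨ cong (2 ^ S *_) (sym (orbit (m + j))) ⟩
    2 ^ S * (3 * xs (m + j) + 1)
      ≡⟨ solve 2 (λ P y → P :* (con 3 :* y :+ con 1) := con 3 :* (P :* y) :+ P) refl (2 ^ S) (xs (m + j)) ⟩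
    3 * (2 ^ S * xs (m + j)) + 2 ^ S
      ≡⟨ cong (λ t → 3 * t + 2 ^ S) (orbit-block a xs orbit m j) ⟩
    3 * (3 ^ j * xs m + blockConst a m j) + 2 ^ S
      ≡⟨ solve 4 (λ Q y c P → con 3 :* (Q :* y :+ c) :+ P := (con 3 :* Q) :* y :+ (con 3 :* c :+ P))
               refl (3 ^ j) (xs m) (blockConst a m j) (2 ^ S) ⟩
    3 ^ suc j * xs m + blockConst a m (suc j) ∎
  where
    open ≡-Reasoning
    S = blockSum a m j

SameWindow : (ℕ → ℕ) → ℕ → ℕ → Set
SameWindow a m m' = ∀ i → a (m + suc i) ≡ a (m' + suc i)

blockSum-window : ∀ a m m' → SameWindow a m m' → ∀ j → blockSum a m j ≡ blockSum a m' j
blockSum-window a m m' same zero = refl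
blockSum-window a m m' same (suc j) = cong₂ _+_ (blockSum-window a m m' same j) (same j)

blockConst-window : ∀ a m m' → SameWindow a m m' → ∀ j → blockConst a m j ≡ blockConst a m' j
blockConst-window a m m' same zero = refl
blockConst-window a m m' same (suc j) =
  cong₂ (λ u v → 3 * u + 2 ^ v) (blockConst-window a m m' same j) (blockSum-window a m m' same j)

periodic-window : ∀ a l r → (∀ n → l < n → a n ≡ a (n + r)) → ∀ k → SameWindow a (l + k * r) l
periodic-window a l r per zero i rewrite +-identityʳ l = refl
periodic-window a l r per (suc k) i = begin
    a (l + (r + k * r) + suc i)
      ≡⟨ cong a (solve 4 (λ l r kr i → l :+ (r :+ kr) :+ i := l :+ kr :+ i :+ r) refl l r (k * r) (suc i)) ⟩
    a (l + k * r + suc i + r)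
      ≡⟨ sym (per _ l<n) ⟩
    a (l + k * r + suc i)
      ≡⟨ periodic-window a l r per k i ⟩
    a (l + suc i) ∎
  where
    open ≡-Reasoning
    l<n : l < l + k * r + suc i
    l<n = subst (l <_) (sym (+-suc (l + k * r) i)) (s≤s (≤-trans (m≤m+n l (k * r)) (m≤m+n _ i)))

sampled-recurrence : ∀ a xs → OrbitOf a xs → ∀ l r → (∀ n → l < n → a n ≡ a (n + r)) → ∀ k →
  2 ^ blockSum a l r * xs (l + suc k * r) ≡ 3 ^ r * xs (l + k * r) + blockConst a l r
sampled-recurrence a xs orbit l r per k = begin
    2 ^ blockSum a l r * xs (l + (r + k * r))
      ≡⟨ cong (λ t → 2 ^ blockSum a l r * xs t) (solve 3 (λ l r kr → l :+ (r :+ kr) := l :+ kr :+ r) refl l r (k * r)) ⟩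
    2 ^ blockSum a l r * xs (m + r)
      ≡⟨ cong (λ t → 2 ^ t * xs (m + r)) (sym (blockSum-window a m l window r)) ⟩
    2 ^ blockSum a m r * xs (m + r)
      ≡⟨ orbit-block a xs orbit m r ⟩
    3 ^ r * xs m + blockConst a m r
      ≡⟨ cong (3 ^ r * xs m +_) (blockConst-window a m l window r) ⟩
    3 ^ r * xs m + blockConst a l r ∎
  where
    open ≡-Reasoning
    m = l + k * r
    window = periodic-window a l r per k

affine-to-linear : ∀ P Q c (y : ℕ → ℕ) → P ≤ Q → (∀ k → P * y (suc k) ≡ Q * y k + c) →
  ∀ k → P * ((Q ∸ P) * y (suc k) + c) ≡ Q * ((Q ∸ P) * y k + c)
affine-to-linear P Q c y P≤Q rec k = begin
    P * (D * y (suc k) + c)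
      ≡⟨ solve 4 (λ P D y c → P :* (D :* y :+ c) := D :* (P :* y) :+ P :* c) refl P D (y (suc k)) c ⟩
    D * (P * y (suc k)) + P * c
      ≡⟨ cong (λ t → D * t + P * c) (rec k) ⟩
    D * (Q * y k + c) + P * c
      ≡⟨ solve 5 (λ D Q y c P → D :* (Q :* y :+ c) :+ P :* c := Q :* (D :* y) :+ (P :+ D) :* c) refl D Q (y k) c P ⟩
    Q * (D * y k) + (P + D) * c
      ≡⟨ cong (λ t → Q * (D * y k) + t * c) (m+[n∸m]≡n P≤Q) ⟩
    Q * (D * y k) + Q * c
      ≡⟨ sym (*-distribˡ-+ Q (D * y k) c) ⟩
    Q * (D * y k + c) ∎
  where
    open ≡-Reasoning
    D = Q ∸ P

linear-iterate : ∀ P Q (z : ℕ → ℕ) → (∀ k → P * z (suc k) ≡ Q * z k) → ∀ k → P ^ k * z k ≡ Q ^ k * z 0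
linear-iterate P Q z rec zero = refl
linear-iterate P Q z rec (suc k) = begin
    P * P ^ k * z (suc k)
      ≡⟨ solve 3 (λ P Pk w → P :* Pk :* w := Pk :* (P :* w)) refl P (P ^ k) (z (suc k)) ⟩
    P ^ k * (P * z (suc k))
      ≡⟨ cong (P ^ k *_) (rec k) ⟩
    P ^ k * (Q * z k)
      ≡⟨ solve 3 (λ Pk Q w → Pk :* (Q :* w) := Q :* (Pk :* w)) refl (P ^ k) Q (z k) ⟩
    Q * (P ^ k * z k)
      ≡⟨ cong (Q *_) (linear-iterate P Q z rec k) ⟩
    Q * (Q ^ k * z 0)
      ≡⟨ sym (*-assoc Q _ _) ⟩
    Q * Q ^ k * z 0 ∎
  where open ≡-Reasoning

coprime-2-3 : Coprime 2 3
coprime-2-3 = toWitness {a? = coprime? 2 3} _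

pow2-strip-3 : ∀ j z → 2 ^ j ∣ 3 * z → 2 ^ j ∣ z
pow2-strip-3 zero z _ = 1∣ z
pow2-strip-3 (suc j) z 2^j+1∣3z with coprime-divisor {o = z} coprime-2-3 (∣-trans (m∣m*n (2 ^ j)) 2^j+1∣3z)
... | divides q refl = subst (2 * 2 ^ j ∣_) (*-comm 2 q) (*-monoʳ-∣ 2 (pow2-strip-3 j q 2^j∣3q))
  where
    2^j∣3q : 2 ^ j ∣ 3 * q
    2^j∣3q = *-cancelˡ-∣ 2 (subst (2 * 2 ^ j ∣_) (solve 1 (λ q → con 3 :* (q :* con 2) := con 2 :* (con 3 :* q)) refl q) 2^j+1∣3z)

pow2-strip-3^ : ∀ n j z → 2 ^ j ∣ 3 ^ n * z → 2 ^ j ∣ z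
pow2-strip-3^ zero j z d = subst (2 ^ j ∣_) (+-identityʳ z) d
pow2-strip-3^ (suc n) j z d = pow2-strip-3^ n j z (pow2-strip-3 j _ (subst (2 ^ j ∣_) (*-assoc 3 (3 ^ n) z) d))

n<2^n : ∀ n → n < 2 ^ n
n<2^n zero = s≤s z≤n
n<2^n (suc n) = begin-strict
  suc n           ≡⟨ +-comm 1 n ⟩
  n + 1           <⟨ +-mono-<-≤ (n<2^n n) (m^n>0 2 n) ⟩
  2 ^ n + 2 ^ n   ≡⟨ cong (2 ^ n +_) (sym (+-identityʳ (2 ^ n))) ⟩
  2 ^ suc n       ∎
  where open ≤-Reasoning

pow2-divisor-bound : ∀ {j z} → 1 ≤ z → 2 ^ j ∣ z → j < z
pow2-divisor-bound {j} z≥1 d = <-≤-trans (n<2^n j) (∣⇒≤ {{>-nonZero z≥1}} d)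

-- No positive sequence is multiplied by 3^r/2^s at every step when s ≥ 1:
-- 2^(s k) would divide 3^(r k) z 0, hence z 0, for every k.
no-positive-scaled-sequence : ∀ s r (z : ℕ → ℕ) → 1 ≤ s →
  (∀ k → 2 ^ s * z (suc k) ≡ 3 ^ r * z k) → ¬ (1 ≤ z 0)
no-positive-scaled-sequence s r z s≥1 rec z0≥1 = <⇒≱ (pow2-divisor-bound z0≥1 2^sz0∣z0) s*z0≥z0
  where
    z0 = z 0
    iterated : 3 ^ (r * z0) * z0 ≡ z z0 * 2 ^ (s * z0)
    iterated = begin
      3 ^ (r * z0) * z0    ≡⟨ cong (_* z0) (sym (^-*-assoc 3 r z0)) ⟩
      (3 ^ r) ^ z0 * z0    ≡⟨ sym (linear-iterate (2 ^ s) (3 ^ r) z rec z0) ⟩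
      (2 ^ s) ^ z0 * z z0  ≡⟨ *-comm _ (z z0) ⟩
      z z0 * (2 ^ s) ^ z0  ≡⟨ cong (z z0 *_) (^-*-assoc 2 s z0) ⟩
      z z0 * 2 ^ (s * z0)  ∎
      where open ≡-Reasoning
    2^sz0∣z0 : 2 ^ (s * z0) ∣ z0
    2^sz0∣z0 = pow2-strip-3^ (r * z0) (s * z0) z0 (divides (z z0) iterated)
    s*z0≥z0 : z0 ≤ s * z0
    s*z0≥z0 = subst (_≤ s * z0) (*-identityˡ z0) (*-monoˡ-≤ z0 s≥1)

blockSum-pos : ∀ a → IsESeq a → ∀ l r → 1 ≤ r → 1 ≤ blockSum a l r
blockSum-pos a positive l (suc r) _ =
  ≤-trans (positive (l + suc r) (subst (1 ≤_) (sym (+-suc l r)) (s≤s z≤n))) (m≤n+m _ (blockSum a l r))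


blockConst-pos : ∀ a l r → 1 ≤ r → 1 ≤ blockConst a l r
blockConst-pos a l (suc r) _ = ≤-trans (m^n>0 2 (blockSum a l r)) (m≤n+m _ (3 * blockConst a l r))

theorem3p4 : (a : ℕ → ℕ) → IsESeq a → (l r : ℕ) → 1 ≤ r →
    (∀ n → l < n → a n ≡ a (n + r)) →
    2 ^ blockSum a l r < 3 ^ r →
    ΩDivergent a
theorem3p4 a positive l r r≥1 per 2^S<3^r x _ _ (xs , _ , orbit , _) =
  no-positive-scaled-sequence S r z (blockSum-pos a positive l r r≥1) z-rec z0≥1
  where
    S = blockSum a l r
    c = blockConst a l r
    y : ℕ → ℕ
    y k = xs (l + k * r)
    z : ℕ → ℕ
    z k = (3 ^ r ∸ 2 ^ S) * y k + c
    z-rec : ∀ k → 2 ^ S * z (suc k) ≡ 3 ^ r * z k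
    z-rec = affine-to-linear (2 ^ S) (3 ^ r) c y (<⇒≤ 2^S<3^r) (sampled-recurrence a xs orbit l r per)
    z0≥1 : 1 ≤ z 0
    z0≥1 = ≤-trans (blockConst-pos a l r r≥1) (m≤n+m c _)
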